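{- Let $G$ be a graph, let $t\ge 0$ be an integer, and let $H$ be a $t$-shallow minor of $G$. Then $$\frac{\beta(H)}{\alpha(H)}\le \hat\beta_t(G),$$ where $\alpha(H)$ is the size of a largest independent set in $H$.
   Context: All graphs are finite, simple and undirected. A $t$-shallow minor (or $t$-minor) of a graph $G$ is a graph obtained from $G$ by contracting pairwise disjoint connected subgraphs, each of radius at most $t$, into single vertices, and deleting vertices (but not edges). For a graph $H$, $\beta(H)$ denotes the clique cover number of $H$, i.e. the minimum number of cliques partitioning $V(H)$. For $x\in V(H)$, $H_x$ denotes the subgraph of $H$ induced by the closed neighborhood of $x$. Let $\tilde\beta(H)=\min_{x\in V(H)}\beta(H_x)$. The largest reduced neighborhood clique cover number $\hat\beta_t(G)$ is the maximum of $\tilde\beta(H)$ over all $t$-shallow minors $H$ of $G$. -}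

module Defs where

open import Data.Nat using (ℕ; zero; suc; _≤_; _*_)
open import Data.Fin using (Fin)
open import Data.Bool using (Bool; true; false)
open import Data.Maybe using (Maybe; just)
open import Data.Product using (Σ; _×_; ∃; ∃-syntax)
open import Function.Definitions using (Injective)
open import Relation.Binary.PropositionalEquality using (_≡_; _≢_)

record Graph : Set where
  field
    n      : ℕ
    adj    : Fin n → Fin n → Bool
    sym    : ∀ u v → adj u v ≡ adj v u
    irrefl : ∀ u → adj u u ≡ false

open Graph public

V : Graph → Set
V G = Fin (n G)

Adj : (G : Graph) → V G → V G → Set
Adj G u v = adj G u v ≡ true

ClosedNbhd : (H : Graph) → V H → V H → Set
ClosedNbhd H x v = (v ≡ x) Data.Sum.⊎ Adj H x v
  where import Data.Sum

-- Clique cover of the induced subgraph H[S] using at most k cliques: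
-- an assignment of the vertices of S to k classes, each class a clique.
-- (Minimising over k, empty classes are irrelevant, so the minimum is
-- the clique cover number of H[S].)
CliqueCoverableOn : (H : Graph) → (V H → Set) → ℕ → Set
CliqueCoverableOn H S k =
  Σ (V H → Fin k) λ c →
    ∀ u v → S u → S v → c u ≡ c v → u ≢ v → Adj H u v

IsBetaOn : (H : Graph) → (V H → Set) → ℕ → Set
IsBetaOn H S b =
  CliqueCoverableOn H S b × (∀ k → CliqueCoverableOn H S k → b ≤ k)

IsBeta : Graph → ℕ → Set
IsBeta H b = IsBetaOn H (λ _ → ⊤) b
  where open import Data.Unit using (⊤)

HasIndependent : Graph → ℕ → Set
HasIndependent H a =
  Σ (Fin a → V H) λ f → Injective _≡_ _≡_ f × (∀ i j → adj H (f i) (f j) ≡ false)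

IsAlpha : Graph → ℕ → Set
IsAlpha H a = HasIndependent H a × (∀ k → HasIndependent H k → k ≤ a)

IsBetaTilde : Graph → ℕ → Set
IsBetaTilde H m =
  (∃[ x ] IsBetaOn H (ClosedNbhd H x) m) ×
  (∀ x m' → IsBetaOn H (ClosedNbhd H x) m' → m ≤ m')

data WalkIn (G : Graph) (P : V G → Set) : V G → V G → ℕ → Set where
  stay : ∀ {u} → P u → WalkIn G P u u zero
  step : ∀ {u w v ℓ} → P u → Adj G u w → WalkIn G P w v ℓ → WalkIn G P u v (suc ℓ)

-- H is a t-shallow minor of G.  ρ sends a vertex of G to the vertex of H
-- whose branch set contains it (nothing = deleted); branch sets are thus
-- pairwise disjoint.  Each branch set has a centre from which every vertex
-- of the branch set is reachable by a walk of length ≤ t inside it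
-- (connected, radius ≤ t).  Since only vertices (not edges) are deleted,
-- distinct x, y are adjacent in H iff some edge of G joins their branch sets.
record ShallowMinor (t : ℕ) (H G : Graph) : Set where
  field
    ρ      : V G → Maybe (V H)
    centre : V H → V G
    centre-in : ∀ x → ρ (centre x) ≡ just x
    radius : ∀ x u → ρ u ≡ just x →
               ∃[ ℓ ] (ℓ ≤ t × WalkIn G (λ w → ρ w ≡ just x) (centre x) u ℓ)
    edges  : ∀ x y → x ≢ y →
               (Adj H x y → ∃[ u ] ∃[ v ] (ρ u ≡ just x × ρ v ≡ just y × Adj G u v))
               × (∃[ u ] ∃[ v ] (ρ u ≡ just x × ρ v ≡ just y × Adj G u v) → Adj H x y)

-- m = β̂_t(G) = max over t-shallow minors H' of G of β̃(H')
-- (only nonempty H' have β̃ defined).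
IsBetaHat : ℕ → Graph → ℕ → Set
IsBetaHat t G m =
  (Σ Graph λ H' → ShallowMinor t H' G × IsBetaTilde H' m) ×
  (∀ (H' : Graph) m' → ShallowMinor t H' G → IsBetaTilde H' m' → m' ≤ m)

-- Greedy argument.  In a nonempty t-shallow minor H of G pick x attaining β̃(H), so that
-- N[x] is covered by β̃(H) ≤ β̂_t(G) cliques.  Deleting N[x] leaves an induced subgraph of H,
-- again a t-shallow minor of G; inductively it has an independent set of some size s and a
-- clique cover by s · β̂_t(G) cliques, and adding x gives the same for H with s + 1.  Hence
-- β(H) ≤ s · β̂_t(G) ≤ α(H) · β̂_t(G).  The minimising x exists only classically, so the
-- induction runs in the double-negation monad, which the decidable goal escapes at the end.

module Submission where

open import Defs
open import Data.Nat using (ℕ; _≤_; _*_)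
open import Data.Nat.Base using (zero; suc; _+_; _<_)
open import Data.Nat.Properties using (_≤?_; *-comm; *-monoˡ-≤; ≮⇒≥; module ≤-Reasoning)
open import Data.Nat.Induction using (<-rec)
open import Data.Fin.Base as Fin using (Fin; _↑ˡ_; _↑ʳ_; inject≤; splitAt)
open import Data.Fin.Properties as Fin
  using (any?; ¬Fin0; ↑ˡ-injective; ↑ʳ-injective; inject≤-injective; splitAt-↑ˡ; splitAt-↑ʳ)
open import Data.Bool.Base using (true; false)
import Data.Bool.Properties as Bool
open import Data.Maybe.Base as Maybe using (Maybe; just; nothing)
open import Data.List.Base using (List; filter; lookup; allFin; length)
open import Data.List.Properties using (filter-notAll; length-tabulate)
open import Data.List.Membership.Propositional using (_∈_)
open import Data.List.Membership.Propositional.Properties using (∈-filter⁺; ∈-filter⁻; ∈-lookup; ∈-allFin)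
import Data.List.Relation.Unary.All as All
open import Data.List.Relation.Unary.AllPairs using (_∷_)
open import Data.List.Relation.Unary.Any as Any using (index)
open import Data.List.Relation.Unary.Any.Properties using (lookup-index)
open import Data.List.Relation.Unary.Unique.Propositional using (Unique)
open import Data.List.Relation.Unary.Unique.Propositional.Properties using (allFin⁺; filter⁺)
open import Data.Product using (∃; ∃-syntax; _×_; _,_; proj₁; proj₂)
open import Data.Sum using (inj₁; inj₂)
open import Data.Unit using (⊤; tt)
open import Effect.Monad using (RawMonad)
open import Function using (_∘_; id)
open import Function.Definitions using (Injective)
open import Level using (0ℓ)
open import Relation.Nullary using (¬_; Dec; yes; no; contradiction)
open import Relation.Nullary.Decidable using (¬?; _⊎-dec_; decidable-stable; ¬¬-excluded-middle)
open import Relation.Nullary.Negation using (¬¬-Monad)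
open import Relation.Unary using (Pred; Decidable)
open import Relation.Binary.PropositionalEquality
  using (_≡_; _≢_; refl; trans; cong; subst) renaming (sym to ≡-sym)

open RawMonad (¬¬-Monad {0ℓ}) using (pure; _>>=_)

IsLeast : Pred ℕ 0ℓ → ℕ → Set
IsLeast P k = P k × (∀ j → P j → k ≤ j)

¬¬-least : ∀ {P : Pred ℕ 0ℓ} n → P n → ¬ ¬ ∃ (IsLeast P)
¬¬-least {P} = <-rec (λ n → P n → ¬ ¬ ∃ (IsLeast P)) least-below
  where
  least-below : ∀ n → (∀ {j} → j < n → P j → ¬ ¬ ∃ (IsLeast P)) → P n → ¬ ¬ ∃ (IsLeast P)
  least-below n rec pn = do
    yes (j , j<n , pj) ← ¬¬-excluded-middle {A = ∃[ j ] j < n × P j}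
      where no none → pure (n , pn , λ j pj → ≮⇒≥ (λ j<n → none (j , j<n , pj)))
    rec j<n pj

lookup-injective : ∀ {A : Set} {xs : List A} → Unique xs → Injective _≡_ _≡_ (lookup xs)
lookup-injective (_  ∷ _)  {Fin.zero}  {Fin.zero}  _  = refl
lookup-injective (x≢ ∷ _)  {Fin.zero}  {Fin.suc j} eq = contradiction eq (All.lookup x≢ (∈-lookup j))
lookup-injective (x≢ ∷ _)  {Fin.suc i} {Fin.zero}  eq = contradiction (≡-sym eq) (All.lookup x≢ (∈-lookup i))
lookup-injective (_  ∷ xs) {Fin.suc i} {Fin.suc j} eq = cong Fin.suc (lookup-injective xs eq)

↑ˡ≢↑ʳ : ∀ {a} b (i : Fin a) (j : Fin b) → i ↑ˡ b ≢ a ↑ʳ j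
↑ˡ≢↑ʳ {a} b i j eq
  with () ← trans (≡-sym (splitAt-↑ˡ a i b)) (trans (cong (splitAt a) eq) (splitAt-↑ʳ a b j))

module _ {k m : ℕ} (e : Fin k → Fin m) where

  preimage : Fin m → Maybe (Fin k)
  preimage v with any? (λ i → e i Fin.≟ v)
  ... | yes (i , _) = just i
  ... | no _        = nothing

  preimage-sound : ∀ {v i} → preimage v ≡ just i → e i ≡ v
  preimage-sound {v} eq with any? (λ i → e i Fin.≟ v)
  preimage-sound refl | yes (_ , ei≡v) = ei≡v
  preimage-sound ()   | no _

  preimage-injective : Injective _≡_ _≡_ e → ∀ i → preimage (e i) ≡ just i
  preimage-injective inj i with any? (λ j → e j Fin.≟ e i)
  ... | yes (_ , ej≡ei) = cong just (inj ej≡ei)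
  ... | no none         = contradiction (i , refl) none

closedNbhd? : (H : Graph) (x : V H) → Decidable (ClosedNbhd H x)
closedNbhd? H x v = (v Fin.≟ x) ⊎-dec (adj H x v Bool.≟ true)

coverable-by-singletons : (H : Graph) (S : Pred (V H) 0ℓ) → CliqueCoverableOn H S (n H)
coverable-by-singletons H S = id , λ u v _ _ u≡v u≢v → contradiction u≡v u≢v

¬¬-betaTilde : (H : Graph) → V H → ¬ ¬ ∃ (IsBetaTilde H)
¬¬-betaTilde H x₀ = do
  (b₀ , βx₀) ← ¬¬-least (n H) (coverable-by-singletons H (ClosedNbhd H x₀))
  (m , (x , βx) , minimal) ← ¬¬-least {λ m → ∃[ x ] IsBetaOn H (ClosedNbhd H x) m} b₀ (x₀ , βx₀)
  pure (m , (x , βx) , λ y m′ βy → minimal m′ (y , βy))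

induced : (H : Graph) {k : ℕ} → (Fin k → V H) → Graph
induced H {k} e = record
  { n      = k
  ; adj    = λ u v → adj H (e u) (e v)
  ; sym    = λ u v → sym H (e u) (e v)
  ; irrefl = irrefl H ∘ e
  }

WalkIn-map : ∀ {G : Graph} {P Q : Pred (V G) 0ℓ} {u v ℓ} →
             (∀ w → P w → Q w) → WalkIn G P u v ℓ → WalkIn G Q u v ℓ
WalkIn-map P⊆Q (stay pu)        = stay (P⊆Q _ pu)
WalkIn-map P⊆Q (step pu uw wlk) = step (P⊆Q _ pu) uw (WalkIn-map P⊆Q wlk)

induced-shallowMinor : ∀ {t} {H G : Graph} → ShallowMinor t H G →
                       ∀ {k} {e : Fin k → V H} → Injective _≡_ _≡_ e →
                       ShallowMinor t (induced H e) G
induced-shallowMinor {t} {H} {G} M {k} {e} inj = record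
  { ρ         = ρ′
  ; centre    = centre ∘ e
  ; centre-in = λ x → ρ′-just⁺ (centre-in (e x))
  ; radius    = λ x u ρ′u≡x →
      let (ℓ , ℓ≤t , wlk) = radius (e x) u (ρ′-just⁻ ρ′u≡x)
      in ℓ , ℓ≤t , WalkIn-map (λ _ → ρ′-just⁺) wlk
  ; edges     = λ x y x≢y →
      let (adj⇒edge , edge⇒adj) = edges (e x) (e y) (x≢y ∘ inj)
      in (λ xy → let (u , v , ρu , ρv , uv) = adj⇒edge xy
                 in u , v , ρ′-just⁺ ρu , ρ′-just⁺ ρv , uv)
       , (λ (u , v , ρ′u , ρ′v , uv) → edge⇒adj (u , v , ρ′-just⁻ ρ′u , ρ′-just⁻ ρ′v , uv))
  }
  where
  open ShallowMinor M

  ρ′ : V G → Maybe (Fin k)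
  ρ′ u = ρ u Maybe.>>= preimage e

  ρ′-just⁻ : ∀ {u i} → ρ′ u ≡ just i → ρ u ≡ just (e i)
  ρ′-just⁻ {u} eq with ρ u
  ... | just y = cong just (≡-sym (preimage-sound e eq))

  ρ′-just⁺ : ∀ {u i} → ρ u ≡ just (e i) → ρ′ u ≡ just i
  ρ′-just⁺ {u} {i} eq rewrite eq = preimage-injective e inj i

module _ (H : Graph) (x : V H) where

  outsideNbhd : List (V H)
  outsideNbhd = filter (¬? ∘ closedNbhd? H x) (allFin (n H))

  _∖N[_] : Graph
  _∖N[_] = induced H (lookup outsideNbhd)

  outsideNbhd-injective : Injective _≡_ _≡_ (lookup outsideNbhd)
  outsideNbhd-injective = lookup-injective (filter⁺ (¬? ∘ closedNbhd? H x) (allFin⁺ (n H)))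

  outsideNbhd-sound : ∀ i → ¬ ClosedNbhd H x (lookup outsideNbhd i)
  outsideNbhd-sound i = proj₂ (∈-filter⁻ (¬? ∘ closedNbhd? H x) {xs = allFin (n H)} (∈-lookup i))

  outsideNbhd-complete : ∀ v → ¬ ClosedNbhd H x v → ∃[ i ] lookup outsideNbhd i ≡ v
  outsideNbhd-complete v v∉N[x] = index v∈ , ≡-sym (lookup-index v∈)
    where
    v∈ : v ∈ outsideNbhd
    v∈ = ∈-filter⁺ (¬? ∘ closedNbhd? H x) (∈-allFin v) v∉N[x]

  outsideNbhd-shorter : length outsideNbhd < n H
  outsideNbhd-shorter = subst (length outsideNbhd <_) (length-tabulate id)
    (filter-notAll (¬? ∘ closedNbhd? H x) (allFin (n H))
      (Any.map (λ { refl x∉N[x] → x∉N[x] (inj₁ refl) }) (∈-allFin x)))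

coverable-weaken : ∀ {H : Graph} {S : Pred (V H) 0ℓ} {k l} → k ≤ l →
                   CliqueCoverableOn H S k → CliqueCoverableOn H S l
coverable-weaken k≤l (c , clique) =
  (λ v → inject≤ (c v) k≤l) ,
  λ u v su sv eq → clique u v su sv (inject≤-injective k≤l k≤l (c u) (c v) eq)

coverable-split : (H : Graph) {S : Pred (V H) 0ℓ} → Decidable S →
                  ∀ {k} (e : Fin k → V H) → (∀ v → ¬ S v → ∃[ i ] e i ≡ v) →
                  ∀ {a b} → CliqueCoverableOn H S a →
                  CliqueCoverableOn (induced H e) (λ _ → ⊤) b →
                  CliqueCoverableOn H (λ _ → ⊤) (a + b)
coverable-split H {S} S? e onto {a} {b} (c , c-clique) (d , d-clique) =
  (λ v → colour v (S? v)) , λ u v _ _ → clique u v (S? u) (S? v)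
  where
  colour : ∀ v → Dec (S v) → Fin (a + b)
  colour v (yes _)  = c v ↑ˡ b
  colour v (no ¬sv) = a ↑ʳ d (proj₁ (onto v ¬sv))

  clique : ∀ u v (u? : Dec (S u)) (v? : Dec (S v)) → colour u u? ≡ colour v v? → u ≢ v → Adj H u v
  clique u v (yes su) (yes sv) eq = c-clique u v su sv (↑ˡ-injective b (c u) (c v) eq)
  clique u v (yes _)  (no _)   eq = contradiction eq (↑ˡ≢↑ʳ b _ _)
  clique u v (no _)   (yes _)  eq = contradiction (≡-sym eq) (↑ˡ≢↑ʳ b _ _)
  clique u v (no ¬su) (no ¬sv) eq u≢v with onto u ¬su | onto v ¬sv
  ... | i , refl | j , refl = d-clique i j tt tt (↑ʳ-injective a (d i) (d j) eq) (u≢v ∘ cong e)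

independent-extend : (H : Graph) (x : V H) → ∀ {k} {e : Fin k → V H} → Injective _≡_ _≡_ e →
                     (∀ i → ¬ ClosedNbhd H x (e i)) →
                     ∀ {s} → HasIndependent (induced H e) s → HasIndependent H (suc s)
independent-extend H x {e = e} e-inj far {s} (f , f-inj , f-indep) = g , g-inj , g-indep
  where
  g : Fin (suc s) → V H
  g Fin.zero    = x
  g (Fin.suc i) = e (f i)

  g-inj : Injective _≡_ _≡_ g
  g-inj {Fin.zero}  {Fin.zero}  _  = refl
  g-inj {Fin.zero}  {Fin.suc j} eq = contradiction (inj₁ (≡-sym eq)) (far (f j))
  g-inj {Fin.suc i} {Fin.zero}  eq = contradiction (inj₁ eq) (far (f i))
  g-inj {Fin.suc i} {Fin.suc j} eq = cong Fin.suc (f-inj (e-inj eq))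

  x-nonadjacent : ∀ i → adj H x (e i) ≡ false
  x-nonadjacent i = Bool.¬-not (far i ∘ inj₂)

  g-indep : ∀ i j → adj H (g i) (g j) ≡ false
  g-indep Fin.zero    Fin.zero    = irrefl H x
  g-indep Fin.zero    (Fin.suc j) = x-nonadjacent (f j)
  g-indep (Fin.suc i) Fin.zero    = trans (sym H (e (f i)) x) (x-nonadjacent (f i))
  g-indep (Fin.suc i) (Fin.suc j) = f-indep i j

IndependentCover : ℕ → Graph → Set
IndependentCover m H = ∃[ s ] HasIndependent H s × CliqueCoverableOn H (λ _ → ⊤) (s * m)

independentCover-step : ∀ {m} (H : Graph) (x : V H) → CliqueCoverableOn H (ClosedNbhd H x) m →
                        IndependentCover m (H ∖N[ x ]) → IndependentCover m H
independentCover-step H x cover (s , indep , rest) =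
  suc s ,
  independent-extend H x (outsideNbhd-injective H x) (outsideNbhd-sound H x) indep ,
  coverable-split H (closedNbhd? H x) (lookup (outsideNbhd H x)) (outsideNbhd-complete H x) cover rest

empty-independentCover : ∀ {m} (H : Graph) → n H ≡ 0 → IndependentCover m H
empty-independentCover H n≡0 =
  0 , ((λ ()) , (λ {}) , (λ ())) , subst Fin n≡0 , λ u → contradiction (subst Fin n≡0 u) Fin.¬Fin0

¬¬-independentCover : ∀ {t m} (G : Graph) → IsBetaHat t G m →
                      ∀ H → ShallowMinor t H G → ¬ ¬ IndependentCover m H
¬¬-independentCover {t} {m} G (_ , β̃≤m) H M = <-rec P greedy (n H) H refl M
  where
  P : ℕ → Set
  P N = ∀ H → n H ≡ N → ShallowMinor t H G → ¬ ¬ IndependentCover m H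

  greedy : ∀ N → (∀ {N′} → N′ < N → P N′) → P N
  greedy zero    _   H n≡0 _ = pure (empty-independentCover H n≡0)
  greedy (suc N) rec H n≡ M = do
    (m′ , β̃H@((x , cover , _) , _)) ← ¬¬-betaTilde H (subst Fin (≡-sym n≡) Fin.zero)
    rest ← rec (subst (n (H ∖N[ x ]) <_) n≡ (outsideNbhd-shorter H x)) (H ∖N[ x ]) refl
               (induced-shallowMinor M (outsideNbhd-injective H x))
    let cover≤m = coverable-weaken {H} {ClosedNbhd H x} (β̃≤m H m′ M β̃H) cover
    pure (independentCover-step H x cover≤m rest)

theorem2p3 : (G : Graph) (t : ℕ) (H : Graph) → ShallowMinor t H G →
    ∀ (a b m : ℕ) → IsAlpha H a → IsBeta H b → IsBetaHat t G m →
    b ≤ m * a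
theorem2p3 G t H M a b m (_ , α-max) (_ , β-min) β̂ = decidable-stable (b ≤? m * a) do
  (s , independent , cover) ← ¬¬-independentCover G β̂ H M
  pure (begin
    b      ≤⟨ β-min (s * m) cover ⟩
    s * m  ≤⟨ *-monoˡ-≤ m (α-max s independent) ⟩
    a * m  ≡⟨ *-comm a m ⟩
    m * a  ∎)
  where open ≤-Reasoning
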